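{- Let $d\ge2$ be an integer, $V=\{1,\dots,d\}$, and let $\mathbf{\Delta}=(\mathbf{\Delta}_2,\dots,\mathbf{\Delta}_d)$ satisfy $0<\mathbf{\Delta}_\ell<1$ for $2\le\ell\le d$ and $\delta:=\mathbf{\Delta}_2=\max_{2\le\ell\le d}\mathbf{\Delta}_\ell$. Let $E=\{\{1,j\}:2\le j\le d\}$ be the star edge set. Then $g(E,\mathbf{\Delta})=-(d-1)+(d-1)\delta$, achieved by the cover $\mathcal{U}=E=\{\{1,j\}\}_{j=2}^d$.
   Context: A cover of an edge set $E$ spanning vertex set $V$ is a family $\mathcal{U}\subset 2^V$ such that (i) every $u\in\mathcal{U}$ has $|u|\ge2$ and $E\not\subset\bigcup_{u'\in\mathcal{U}\setminus\{u\}}\binom{u'}{2}$, and (ii) $E\subset\bigcup_{u\in\mathcal{U}}\binom{u}{2}$, where $\binom{u}{2}$ is the set of 2-element subsets of $u$. For a vector $\mathbf{\Delta}=(\mathbf{\Delta}_2,\dots,\mathbf{\Delta}_{|V|})$ with entries $<1$, $g(E,\mathbf{\Delta})=\max_{\mathcal{U}}\sum_{u\in\mathcal{U}}\left(1+\mathbf{\Delta}_{|u|}-|u|\right)$, the maximum over all covers $\mathcal{U}$ of $E$. -}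

module Defs where

open import Level using (Level; _⊔_) renaming (suc to lsuc)
open import Data.Nat as ℕ using (ℕ; zero; suc)
open import Data.Fin using (Fin; toℕ)
open import Data.Fin.Subset using (Subset; _∈_; ∣_∣)
open import Data.List using (List; []; _∷_)
open import Data.List.Relation.Unary.All using (All)
open import Data.List.Relation.Unary.Any using (Any)
open import Data.List.Relation.Unary.Unique.Propositional using (Unique)
open import Data.Product using (_×_)
open import Data.Sum using (_⊎_)
open import Relation.Binary.Core using (Rel)
open import Relation.Binary.Structures using (IsTotalOrder)
open import Relation.Binary.PropositionalEquality using (_≡_; _≢_)
open import Relation.Nullary using (¬_)
open import Algebra.Bundles using (CommutativeRing)

-- Ordered commutative rings (stdlib has no reals; the statement is
-- proved for every ordered commutative ring, ℝ being one instance).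

record OrderedCommutativeRing (c ℓ₁ ℓ₂ : Level) : Set (lsuc (c ⊔ ℓ₁ ⊔ ℓ₂)) where
  field
    commutativeRing : CommutativeRing c ℓ₁
  open CommutativeRing commutativeRing public
  infix 4 _≤_
  field
    _≤_          : Rel Carrier ℓ₂
    isTotalOrder : IsTotalOrder _≈_ _≤_
    +-monoˡ-≤    : ∀ {x y} z → x ≤ y → (x + z) ≤ (y + z)
    *-nonneg     : ∀ {x y} → 0# ≤ x → 0# ≤ y → 0# ≤ (x * y)

  infix 4 _<_
  _<_ : Rel Carrier (ℓ₁ ⊔ ℓ₂)
  x < y = (x ≤ y) × ¬ (x ≈ y)

  ι : ℕ → Carrier
  ι zero    = 0#
  ι (suc n) = 1# + ι n

  Σ[_] : List Carrier → Carrier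
  Σ[ [] ]     = 0#
  Σ[ x ∷ xs ] = x + Σ[ xs ]

-- Edge sets on V = Fin d (vertex k+1 of the paper is the element of
-- Fin d with toℕ = k).  An edge set is a relation E; E i j means {i,j}
-- is an edge (used with i ≢ j and symmetric).

EdgeSet : ℕ → Set₁
EdgeSet d = Fin d → Fin d → Set

-- Families 𝒰 ⊂ 2^V: duplicate-free lists of subsets of V.
Family : ℕ → Set
Family d = List (Subset d)

Covered : ∀ {d} → EdgeSet d → Family d → Set
Covered E 𝒰 = ∀ i j → E i j → Any (λ u → (i ∈ u) × (j ∈ u)) 𝒰

CoveredWithout : ∀ {d} → EdgeSet d → Family d → Subset d → Set
CoveredWithout E 𝒰 u =
  ∀ i j → E i j → Any (λ u' → (u' ≢ u) × (i ∈ u') × (j ∈ u')) 𝒰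

IsCover : ∀ {d} → EdgeSet d → Family d → Set
IsCover E 𝒰 =
  Unique 𝒰
  × All (λ u → (2 ℕ.≤ ∣ u ∣) × ¬ CoveredWithout E 𝒰 u) 𝒰
  × Covered E 𝒰

StarEdge : ∀ d → EdgeSet d
StarEdge d i j = (i ≢ j) × ((toℕ i ≡ 0) ⊎ (toℕ j ≡ 0))

module _ {c ℓ₁ ℓ₂} (R : OrderedCommutativeRing c ℓ₁ ℓ₂) where
  open OrderedCommutativeRing R

  coverValue : ∀ {d} → (ℕ → Carrier) → Family d → Carrier
  coverValue Δ []       = 0#
  coverValue Δ (u ∷ 𝒰) = ((1# + Δ (∣ u ∣)) - ι (∣ u ∣)) + coverValue Δ 𝒰

{-# OPTIONS --safe #-}
module Submission where

-- Every set of a cover of the star contains the centre: a set without it contains no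
-- star edge, so dropping it would leave a cover.  A set with the centre and s ≥ 1 leaves
-- contributes 1 + Δ (1 + s) - (1 + s) ≤ s (δ - 1).  Every leaf lies in some set, so the
-- numbers s add up to at least d - 1, and δ - 1 ≤ 0 turns this into the bound
-- (d - 1)(δ - 1), which the cover by the d - 1 edges attains.

open import Defs
open import Data.Nat as ℕ using (ℕ; zero; suc; _∸_; z≤n; s≤s; s≤s⁻¹)
import Data.Nat.Properties as ℕₚ
open import Data.Nat.ListAction using (sum)
open import Data.Fin as Fin using (Fin)
open import Data.Fin.Subset using (Subset; ⁅_⁆; _∪_; ⋃; ⊤; ∣_∣; _∈_; _⊆_; inside; outside)
open import Data.Fin.Subset.Properties
  using (_∈?_; p⊆p∪q; q⊆p∪q; x∈⁅x⁆; x∈⁅y⁆⇒x≡y; ∣⁅x⁆∣≡1; ∣⊥∣≡0; ∣⊤∣≡n; ∣p∣≤n; p⊆q⇒∣p∣≤∣q∣; ∪-identityˡ; ∪-identityʳ)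
open import Data.Vec using ([]; _∷_; here; there; tail)
open import Data.List using (List; []; _∷_; map; length; tabulate)
open import Data.List.Properties using (map-∘; length-tabulate)
open import Data.List.Relation.Unary.Any using (Any; here; there)
import Data.List.Relation.Unary.Any as Any
import Data.List.Relation.Unary.Any.Properties as Anyₚ
open import Data.List.Relation.Unary.All using (All; []; _∷_)
import Data.List.Relation.Unary.All as All
import Data.List.Relation.Unary.All.Properties as Allₚ
import Data.List.Relation.Unary.Unique.Propositional.Properties as Uniqueₚ
open import Data.Product using (_×_; _,_; proj₁; proj₂; ∃-syntax)
open import Data.Sum using (inj₁; inj₂)
open import Data.Empty using (⊥)
open import Function using (_∘_)
open import Function.Bundles using (_⇔_; mk⇔)
open import Relation.Nullary using (¬_; yes; no; contradiction)
open import Relation.Binary.PropositionalEquality using (_≡_)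
import Relation.Binary.PropositionalEquality as P
open import Relation.Binary.Bundles using (Poset)
open import Relation.Binary.Structures using (IsTotalOrder)
import Relation.Binary.Reasoning.PartialOrder as PartialOrderReasoning
import Algebra.Properties.Ring as RingProperties
import Algebra.Properties.CommutativeSemigroup as CommutativeSemigroupProperties

∣p∪q∣≤∣p∣+∣q∣ : ∀ {n} (p q : Subset n) → ∣ p ∪ q ∣ ℕ.≤ ∣ p ∣ ℕ.+ ∣ q ∣
∣p∪q∣≤∣p∣+∣q∣ []            []            = z≤n
∣p∪q∣≤∣p∣+∣q∣ (outside ∷ p) (outside ∷ q) = ∣p∪q∣≤∣p∣+∣q∣ p q
∣p∪q∣≤∣p∣+∣q∣ (outside ∷ p) (inside  ∷ q) =
  ℕₚ.≤-trans (s≤s (∣p∪q∣≤∣p∣+∣q∣ p q)) (ℕₚ.≤-reflexive (P.sym (ℕₚ.+-suc ∣ p ∣ ∣ q ∣)))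
∣p∪q∣≤∣p∣+∣q∣ (inside  ∷ p) (outside ∷ q) = s≤s (∣p∪q∣≤∣p∣+∣q∣ p q)
∣p∪q∣≤∣p∣+∣q∣ (inside  ∷ p) (inside  ∷ q) =
  s≤s (ℕₚ.≤-trans (∣p∪q∣≤∣p∣+∣q∣ p q) (ℕₚ.+-monoʳ-≤ ∣ p ∣ (ℕₚ.n≤1+n ∣ q ∣)))

∣⋃ps∣≤sum∣ps∣ : ∀ {n} (ps : List (Subset n)) → ∣ ⋃ ps ∣ ℕ.≤ sum (map ∣_∣ ps)
∣⋃ps∣≤sum∣ps∣ {n} []       = ℕₚ.≤-reflexive (∣⊥∣≡0 n)
∣⋃ps∣≤sum∣ps∣     (p ∷ ps) =
  ℕₚ.≤-trans (∣p∪q∣≤∣p∣+∣q∣ p (⋃ ps)) (ℕₚ.+-monoʳ-≤ ∣ p ∣ (∣⋃ps∣≤sum∣ps∣ ps))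

∈⋃⁺ : ∀ {n} {x : Fin n} {ps : List (Subset n)} → Any (x ∈_) ps → x ∈ ⋃ ps
∈⋃⁺ {ps = p ∷ ps} (here  x∈p)  = p⊆p∪q (⋃ ps) x∈p
∈⋃⁺ {ps = p ∷ ps} (there x∈ps) = q⊆p∪q p (⋃ ps) (∈⋃⁺ x∈ps)

module OrderedCommutativeRingProperties {c ℓ₁ ℓ₂} (R : OrderedCommutativeRing c ℓ₁ ℓ₂) where

  open OrderedCommutativeRing R
  open IsTotalOrder isTotalOrder using (total) renaming (trans to ≤-trans; refl to ≤-refl)
  open RingProperties ring using (-‿involutive; -‿distribʳ-*; -‿+-comm; -1*x≈-x; x[y-z]≈xy-xz)
  open CommutativeSemigroupProperties +-commutativeSemigroup using (interchange)

  poset : Poset c ℓ₁ ℓ₂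
  poset = record { isPartialOrder = IsTotalOrder.isPartialOrder isTotalOrder }

  open PartialOrderReasoning poset public

  +-monoʳ-≤ : ∀ z {x y} → x ≤ y → z + x ≤ z + y
  +-monoʳ-≤ z {x} {y} x≤y = begin
    z + x  ≈⟨ +-comm z x ⟩
    x + z  ≤⟨ +-monoˡ-≤ z x≤y ⟩
    y + z  ≈⟨ +-comm y z ⟩
    z + y  ∎

  +-mono-≤ : ∀ {x y u v} → x ≤ y → u ≤ v → x + u ≤ y + v
  +-mono-≤ {y = y} {u} x≤y u≤v = ≤-trans (+-monoˡ-≤ u x≤y) (+-monoʳ-≤ y u≤v)

  x≤0⇒0≤-x : ∀ {x} → x ≤ 0# → 0# ≤ - x
  x≤0⇒0≤-x {x} x≤0 = begin
    0#       ≈⟨ -‿inverseʳ x ⟨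
    x + - x  ≤⟨ +-monoˡ-≤ (- x) x≤0 ⟩
    0# + - x ≈⟨ +-identityˡ (- x) ⟩
    - x      ∎

  0≤-x⇒x≤0 : ∀ {x} → 0# ≤ - x → x ≤ 0#
  0≤-x⇒x≤0 {x} 0≤-x = begin
    x       ≈⟨ +-identityʳ x ⟨
    x + 0#  ≤⟨ +-monoʳ-≤ x 0≤-x ⟩
    x + - x ≈⟨ -‿inverseʳ x ⟩
    0#      ∎

  x≤y⇒x-y≤0 : ∀ {x y} → x ≤ y → x - y ≤ 0#
  x≤y⇒x-y≤0 {x} {y} x≤y = begin
    x - y ≤⟨ +-monoˡ-≤ (- y) x≤y ⟩
    y - y ≈⟨ -‿inverseʳ y ⟩
    0#    ∎

  0≤1 : 0# ≤ 1#
  0≤1 with total 0# 1#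
  ... | inj₁ 0≤1 = 0≤1
  ... | inj₂ 1≤0 = begin
    0#          ≤⟨ *-nonneg 0≤-1 0≤-1 ⟩
    - 1# * - 1# ≈⟨ -1*x≈-x (- 1#) ⟩
    - (- 1#)    ≈⟨ -‿involutive 1# ⟩
    1#          ∎
    where
    0≤-1 : 0# ≤ - 1#
    0≤-1 = x≤0⇒0≤-x 1≤0

  *-nonneg-nonpos : ∀ {x y} → 0# ≤ x → y ≤ 0# → x * y ≤ 0#
  *-nonneg-nonpos {x} {y} 0≤x y≤0 = 0≤-x⇒x≤0 (begin
    0#        ≤⟨ *-nonneg 0≤x (x≤0⇒0≤-x y≤0) ⟩
    x * - y   ≈⟨ -‿distribʳ-* x y ⟨
    - (x * y) ∎)

  1+x-[1+y]≈x-y : ∀ x y → (1# + x) - (1# + y) ≈ x - y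
  1+x-[1+y]≈x-y x y = begin-equality
    (1# + x) - (1# + y)       ≈⟨ +-congˡ (-‿+-comm 1# y) ⟨
    (1# + x) + (- 1# + - y)   ≈⟨ interchange 1# x (- 1#) (- y) ⟩
    (1# - 1#) + (x - y)       ≈⟨ +-congʳ (-‿inverseʳ 1#) ⟩
    0# + (x - y)              ≈⟨ +-identityˡ (x - y) ⟩
    x - y                     ∎

  x*[y-1]≈-x+x*y : ∀ x y → x * (y - 1#) ≈ - x + x * y
  x*[y-1]≈-x+x*y x y = begin-equality
    x * (y - 1#)   ≈⟨ x[y-z]≈xy-xz x y 1# ⟩
    x * y - x * 1# ≈⟨ +-congˡ (-‿cong (*-identityʳ x)) ⟩
    x * y - x      ≈⟨ +-comm (x * y) (- x) ⟩
    - x + x * y    ∎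

  0≤ι : ∀ n → 0# ≤ ι n
  0≤ι zero    = ≤-refl
  0≤ι (suc n) = begin
    0#       ≈⟨ +-identityʳ 0# ⟨
    0# + 0#  ≤⟨ +-mono-≤ 0≤1 (0≤ι n) ⟩
    1# + ι n ∎

  ι-homo-+ : ∀ m n → ι (m ℕ.+ n) ≈ ι m + ι n
  ι-homo-+ zero    n = sym (+-identityˡ (ι n))
  ι-homo-+ (suc m) n = trans (+-congˡ (ι-homo-+ m n)) (sym (+-assoc 1# (ι m) (ι n)))

  ι-*-homo-+ : ∀ m n x → ι (m ℕ.+ n) * x ≈ ι m * x + ι n * x
  ι-*-homo-+ m n x = trans (*-congʳ (ι-homo-+ m n)) (distribʳ x (ι m) (ι n))

  ι-suc-* : ∀ n x → ι (suc n) * x ≈ x + ι n * x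
  ι-suc-* n x = trans (distribʳ x 1# (ι n)) (+-congʳ (*-identityˡ x))

  ι-*-antitone : ∀ {w} → w ≤ 0# → ∀ {m n} → m ℕ.≤ n → ι n * w ≤ ι m * w
  ι-*-antitone {w} w≤0 {m} {n} m≤n = begin
    ι n * w                  ≡⟨ P.cong (λ k → ι k * w) (ℕₚ.m+[n∸m]≡n m≤n) ⟨
    ι (m ℕ.+ (n ∸ m)) * w    ≈⟨ ι-*-homo-+ m (n ∸ m) w ⟩
    ι m * w + ι (n ∸ m) * w  ≤⟨ +-monoʳ-≤ (ι m * w) (*-nonneg-nonpos (0≤ι (n ∸ m)) w≤0) ⟩
    ι m * w + 0#             ≈⟨ +-identityʳ (ι m * w) ⟩
    ι m * w                  ∎

module CoverValue {c ℓ₁ ℓ₂} (R : OrderedCommutativeRing c ℓ₁ ℓ₂)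
                  (Δ : ℕ → OrderedCommutativeRing.Carrier R) where

  open OrderedCommutativeRing R
  open OrderedCommutativeRingProperties R
  open RingProperties ring using (-‿+-comm)

  sizeValue : ℕ → Carrier
  sizeValue ℓ = (1# + Δ ℓ) - ι ℓ

  coverValue-≤ : ∀ {d w} (f : Subset d → ℕ) (𝒰 : Family d) →
                 All (λ u → sizeValue ∣ u ∣ ≤ ι (f u) * w) 𝒰 →
                 coverValue R Δ 𝒰 ≤ ι (sum (map f 𝒰)) * w
  coverValue-≤ {w = w} f []       []               = begin
    0#     ≈⟨ zeroˡ w ⟨
    0# * w ∎
  coverValue-≤ {w = w} f (u ∷ 𝒰) (bound ∷ bounds) = begin
    sizeValue ∣ u ∣ + coverValue R Δ 𝒰   ≤⟨ +-mono-≤ bound (coverValue-≤ f 𝒰 bounds) ⟩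
    ι (f u) * w + ι (sum (map f 𝒰)) * w ≈⟨ ι-*-homo-+ (f u) (sum (map f 𝒰)) w ⟨
    ι (f u ℕ.+ sum (map f 𝒰)) * w       ∎

  coverValue-≈ : ∀ {d x} (𝒰 : Family d) →
                 All (λ u → sizeValue ∣ u ∣ ≈ x) 𝒰 → coverValue R Δ 𝒰 ≈ ι (length 𝒰) * x
  coverValue-≈ {x = x} []       []         = sym (zeroˡ x)
  coverValue-≈ {x = x} (u ∷ 𝒰) (eq ∷ eqs) =
    trans (+-cong eq (coverValue-≈ 𝒰 eqs)) (sym (ι-suc-* (length 𝒰) x))

  sizeValue-2 : sizeValue 2 ≈ Δ 2 - 1#
  sizeValue-2 = trans (1+x-[1+y]≈x-y (Δ 2) (1# + 0#)) (+-congˡ (-‿cong (+-identityʳ 1#)))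

  -- The slack is (δ - Δ (1 + s)) + (s - 1) δ ≥ 0.
  sizeValue-≤ : ∀ {δ} → 0# ≤ δ → ∀ s → 1 ℕ.≤ s → Δ (suc s) ≤ δ →
                sizeValue (suc s) ≤ ι s * (δ - 1#)
  sizeValue-≤ {δ} 0≤δ (suc k) _ Δ≤δ = begin
    (1# + D) - (1# + (1# + ι k))  ≈⟨ 1+x-[1+y]≈x-y D (1# + ι k) ⟩
    D - (1# + ι k)                ≈⟨ +-congˡ (-‿+-comm 1# (ι k)) ⟨
    D + (- 1# + - ι k)            ≈⟨ +-assoc D (- 1#) (- ι k) ⟨
    (D - 1#) + - ι k              ≤⟨ +-mono-≤ (+-monoˡ-≤ (- 1#) Δ≤δ) -ιk≤-ιk+ιkδ ⟩
    (δ - 1#) + (- ι k + ι k * δ)  ≈⟨ +-congˡ (x*[y-1]≈-x+x*y (ι k) δ) ⟨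
    (δ - 1#) + ι k * (δ - 1#)     ≈⟨ ι-suc-* k (δ - 1#) ⟨
    ι (suc k) * (δ - 1#)          ∎
    where
    D : Carrier
    D = Δ (suc (suc k))

    -ιk≤-ιk+ιkδ : - ι k ≤ - ι k + ι k * δ
    -ιk≤-ιk+ιkδ = begin
      - ι k              ≈⟨ +-identityʳ (- ι k) ⟨
      - ι k + 0#         ≤⟨ +-monoʳ-≤ (- ι k) (*-nonneg (0≤ι k) 0≤δ) ⟩
      - ι k + ι k * δ    ∎

star-edge⇒0∈ : ∀ {m} {u : Subset (suc m)} {i j} →
               StarEdge (suc m) i j → i ∈ u → j ∈ u → Fin.zero ∈ u
star-edge⇒0∈ {i = Fin.zero}              _            i∈u _   = i∈u
star-edge⇒0∈ {j = Fin.zero}              _            _   j∈u = j∈u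
star-edge⇒0∈ {i = Fin.suc _} {Fin.suc _} (_ , inj₁ ()) _   _
star-edge⇒0∈ {i = Fin.suc _} {Fin.suc _} (_ , inj₂ ()) _   _

star-edge₀ : ∀ {m} (j : Fin m) → StarEdge (suc m) Fin.zero (Fin.suc j)
star-edge₀ j = (λ ()) , inj₁ P.refl

covered-without-edgeless : ∀ {d} {E : EdgeSet d} {𝒰 u} → Covered E 𝒰 →
                           (∀ {i j} → E i j → i ∈ u → j ∈ u → ⊥) → CoveredWithout E 𝒰 u
covered-without-edgeless covered edgeless i j e =
  Any.map (λ (i∈u′ , j∈u′) → (λ { P.refl → edgeless e i∈u′ j∈u′ }) , i∈u′ , j∈u′) (covered i j e)

irredundant-star-member-∋0 : ∀ {m} {𝒰 : Family (suc m)} {u} → Covered (StarEdge (suc m)) 𝒰 →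
                             ¬ CoveredWithout (StarEdge (suc m)) 𝒰 u → Fin.zero ∈ u
irredundant-star-member-∋0 {u = u} covered irredundant with Fin.zero ∈? u
... | yes 0∈u = 0∈u
... | no  0∉u = contradiction
  (covered-without-edgeless covered (λ e i∈u j∈u → 0∉u (star-edge⇒0∈ e i∈u j∈u))) irredundant

leaves⊆⋃tails : ∀ {m} {𝒰 : Family (suc m)} → Covered (StarEdge (suc m)) 𝒰 → ⊤ ⊆ ⋃ (map tail 𝒰)
leaves⊆⋃tails covered {k} _ =
  ∈⋃⁺ (Anyₚ.map⁺ (Any.map (λ { (_ , there k∈p) → k∈p }) (covered Fin.zero (Fin.suc k) (star-edge₀ k))))

star-leaf-count : ∀ {m} {𝒰 : Family (suc m)} → Covered (StarEdge (suc m)) 𝒰 →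
                  m ℕ.≤ sum (map (∣_∣ ∘ tail) 𝒰)
star-leaf-count {m} {𝒰} covered = begin
  m                          ≡⟨ ∣⊤∣≡n m ⟨
  ∣ ⊤ {m} ∣                  ≤⟨ p⊆q⇒∣p∣≤∣q∣ (leaves⊆⋃tails covered) ⟩
  ∣ ⋃ (map tail 𝒰) ∣         ≤⟨ ∣⋃ps∣≤sum∣ps∣ (map tail 𝒰) ⟩
  sum (map ∣_∣ (map tail 𝒰)) ≡⟨ P.cong sum (map-∘ 𝒰) ⟨
  sum (map (∣_∣ ∘ tail) 𝒰)   ∎
  where open ℕₚ.≤-Reasoning

leafEdge : ∀ {m} → Fin m → Subset (suc m)
leafEdge j = inside ∷ ⁅ j ⁆

starCover : ∀ m → Family (suc m)
starCover m = tabulate leafEdge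

leafEdge-injective : ∀ {m} {i j : Fin m} → leafEdge i ≡ leafEdge j → i ≡ j
leafEdge-injective {i = i} {j} eq = x∈⁅y⁆⇒x≡y j (P.subst (i ∈_) (P.cong tail eq) (x∈⁅x⁆ i))

∣leafEdge∣≡2 : ∀ {m} (j : Fin m) → ∣ leafEdge j ∣ ≡ 2
∣leafEdge∣≡2 j = P.cong suc (∣⁅x⁆∣≡1 j)

leafEdge≡⁅0⁆∪⁅j⁆ : ∀ {m} (j : Fin m) → leafEdge j ≡ ⁅ Fin.zero ⁆ ∪ ⁅ Fin.suc j ⁆
leafEdge≡⁅0⁆∪⁅j⁆ j = P.cong (inside ∷_) (P.sym (∪-identityˡ ⁅ j ⁆))

leafEdge≡⁅j⁆∪⁅0⁆ : ∀ {m} (j : Fin m) → leafEdge j ≡ ⁅ Fin.suc j ⁆ ∪ ⁅ Fin.zero ⁆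
leafEdge≡⁅j⁆∪⁅0⁆ j = P.cong (inside ∷_) (P.sym (∪-identityʳ ⁅ j ⁆))

starCover-covers : ∀ m → Covered (StarEdge (suc m)) (starCover m)
starCover-covers m Fin.zero    Fin.zero    (0≢0 , _)    = contradiction P.refl 0≢0
starCover-covers m Fin.zero    (Fin.suc j) _            = Anyₚ.tabulate⁺ j (here , there (x∈⁅x⁆ j))
starCover-covers m (Fin.suc j) Fin.zero    _            = Anyₚ.tabulate⁺ j (there (x∈⁅x⁆ j) , here)
starCover-covers m (Fin.suc _) (Fin.suc _) (_ , inj₁ ())
starCover-covers m (Fin.suc _) (Fin.suc _) (_ , inj₂ ())

-- Only leafEdge j itself covers the edge {0, j + 1}.
starCover-irredundant : ∀ {m} (j : Fin m) → ¬ CoveredWithout (StarEdge (suc m)) (starCover m) (leafEdge j)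
starCover-irredundant j coveredWithout
  with Anyₚ.tabulate⁻ (coveredWithout Fin.zero (Fin.suc j) (star-edge₀ j))
... | k , (leafEdge-k≢leafEdge-j , _ , there j∈⁅k⁆) =
  leafEdge-k≢leafEdge-j (P.cong leafEdge (P.sym (x∈⁅y⁆⇒x≡y k j∈⁅k⁆)))

starCover-isCover : ∀ m → IsCover (StarEdge (suc m)) (starCover m)
starCover-isCover m =
    Uniqueₚ.tabulate⁺ leafEdge-injective
  , Allₚ.tabulate⁺ (λ j → ℕₚ.≤-reflexive (P.sym (∣leafEdge∣≡2 j)) , starCover-irredundant j)
  , starCover-covers m

starCover-members : ∀ {m} u →
  Any (u ≡_) (starCover m) ⇔ (∃[ i ] ∃[ j ] (StarEdge (suc m) i j × u ≡ ⁅ i ⁆ ∪ ⁅ j ⁆))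
starCover-members {m} u = mk⇔ to from
  where
  to : Any (u ≡_) (starCover m) → ∃[ i ] ∃[ j ] (StarEdge (suc m) i j × u ≡ ⁅ i ⁆ ∪ ⁅ j ⁆)
  to u∈starCover with Anyₚ.tabulate⁻ u∈starCover
  ... | j , u≡leafEdge-j = Fin.zero , Fin.suc j , star-edge₀ j , P.trans u≡leafEdge-j (leafEdge≡⁅0⁆∪⁅j⁆ j)

  from : ∃[ i ] ∃[ j ] (StarEdge (suc m) i j × u ≡ ⁅ i ⁆ ∪ ⁅ j ⁆) → Any (u ≡_) (starCover m)
  from (Fin.zero  , Fin.zero  , (0≢0 , _)   , _)  = contradiction P.refl 0≢0
  from (Fin.zero  , Fin.suc j , _           , eq) = Anyₚ.tabulate⁺ j (P.trans eq (P.sym (leafEdge≡⁅0⁆∪⁅j⁆ j)))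
  from (Fin.suc j , Fin.zero  , _           , eq) = Anyₚ.tabulate⁺ j (P.trans eq (P.sym (leafEdge≡⁅j⁆∪⁅0⁆ j)))
  from (Fin.suc _ , Fin.suc _ , (_ , inj₁ ()) , _)
  from (Fin.suc _ , Fin.suc _ , (_ , inj₂ ()) , _)

module _ {c ℓ₁ ℓ₂} (R : OrderedCommutativeRing c ℓ₁ ℓ₂)
         (Δ : ℕ → OrderedCommutativeRing.Carrier R) where

  open OrderedCommutativeRing R
  open OrderedCommutativeRingProperties R
  open CoverValue R Δ

  star-cover⇒coverValue≤ : ∀ {m δ} → 0# ≤ δ → δ ≤ 1# → (∀ ℓ → 2 ℕ.≤ ℓ → ℓ ℕ.≤ suc m → Δ ℓ ≤ δ) →
                           ∀ {𝒰} → IsCover (StarEdge (suc m)) 𝒰 → coverValue R Δ 𝒰 ≤ ι m * (δ - 1#)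
  star-cover⇒coverValue≤ {m} {δ} 0≤δ δ≤1 Δ≤δ {𝒰} (_ , members , covered) = begin
    coverValue R Δ 𝒰                        ≤⟨ coverValue-≤ (∣_∣ ∘ tail) 𝒰 (All.map member-value-≤ members) ⟩
    ι (sum (map (∣_∣ ∘ tail) 𝒰)) * (δ - 1#) ≤⟨ ι-*-antitone (x≤y⇒x-y≤0 δ≤1) (star-leaf-count covered) ⟩
    ι m * (δ - 1#)                          ∎
    where
    value-≤ : ∀ {u : Subset (suc m)} → Fin.zero ∈ u → 2 ℕ.≤ ∣ u ∣ →
              sizeValue ∣ u ∣ ≤ ι ∣ tail u ∣ * (δ - 1#)
    value-≤ {u} here 2≤∣u∣ = sizeValue-≤ 0≤δ _ (s≤s⁻¹ 2≤∣u∣) (Δ≤δ _ 2≤∣u∣ (∣p∣≤n u))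

    member-value-≤ : ∀ {u} → (2 ℕ.≤ ∣ u ∣) × ¬ CoveredWithout (StarEdge (suc m)) 𝒰 u →
                     sizeValue ∣ u ∣ ≤ ι ∣ tail u ∣ * (δ - 1#)
    member-value-≤ (2≤∣u∣ , irredundant) = value-≤ (irredundant-star-member-∋0 covered irredundant) 2≤∣u∣

  starCover-value : ∀ m → coverValue R Δ (starCover m) ≈ ι m * (Δ 2 - 1#)
  starCover-value m = begin-equality
    coverValue R Δ (starCover m)          ≈⟨ coverValue-≈ (starCover m) (Allₚ.tabulate⁺ leafEdge-value) ⟩
    ι (length (starCover m)) * (Δ 2 - 1#) ≡⟨ P.cong (λ n → ι n * (Δ 2 - 1#)) (length-tabulate (leafEdge {m})) ⟩
    ι m * (Δ 2 - 1#)                      ∎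
    where
    leafEdge-value : (j : Fin m) → sizeValue ∣ leafEdge j ∣ ≈ Δ 2 - 1#
    leafEdge-value j = trans (reflexive (P.cong sizeValue (∣leafEdge∣≡2 j))) sizeValue-2

lemma6 : ∀ {c ℓ₁ ℓ₂} (R : OrderedCommutativeRing c ℓ₁ ℓ₂) →
    let open OrderedCommutativeRing R in
    (d : ℕ) → 2 ℕ.≤ d →
    (Δ : ℕ → Carrier) →
    (∀ ℓ → 2 ℕ.≤ ℓ → ℓ ℕ.≤ d → (0# < Δ ℓ) × (Δ ℓ < 1#)) →
    (∀ ℓ → 2 ℕ.≤ ℓ → ℓ ℕ.≤ d → Δ ℓ ≤ Δ 2) →
    -- every cover has value at most -(d-1) + (d-1)δ ...
    (∀ (𝒰 : Family d) → IsCover (StarEdge d) 𝒰 →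
       coverValue R Δ 𝒰 ≤ - ι (d ∸ 1) + ι (d ∸ 1) * Δ 2)
    -- ... and the cover 𝒰 = E = {{1,j}} is a cover attaining it
    × (∃[ 𝒰 ] (IsCover (StarEdge d) 𝒰
               × (∀ u → Any (u ≡_) 𝒰 ⇔ (∃[ i ] ∃[ j ] (StarEdge d i j × u ≡ ⁅ i ⁆ ∪ ⁅ j ⁆)))
               × coverValue R Δ 𝒰 ≈ - ι (d ∸ 1) + ι (d ∸ 1) * Δ 2))
lemma6 R (suc (suc n)) 2≤d@(s≤s (s≤s z≤n)) Δ Δ-bounds Δ≤Δ₂ =
    (λ 𝒰 isCover → begin
      coverValue R Δ 𝒰 ≤⟨ star-cover⇒coverValue≤ R Δ 0≤δ δ≤1 Δ≤Δ₂ isCover ⟩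
      ι m * (Δ 2 - 1#) ≈⟨ x*[y-1]≈-x+x*y (ι m) (Δ 2) ⟩
      - ι m + ι m * Δ 2 ∎)
  , starCover m , starCover-isCover m , starCover-members
  , trans (starCover-value R Δ m) (x*[y-1]≈-x+x*y (ι m) (Δ 2))
  where
  open OrderedCommutativeRing R
  open OrderedCommutativeRingProperties R

  m : ℕ
  m = suc n

  0≤δ : 0# ≤ Δ 2
  0≤δ = proj₁ (proj₁ (Δ-bounds 2 ℕₚ.≤-refl 2≤d))

  δ≤1 : Δ 2 ≤ 1#
  δ≤1 = proj₁ (proj₂ (Δ-bounds 2 ℕₚ.≤-refl 2≤d))
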